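{- Let $G$ be a simple graph with vertices $v_1,\dots,v_n$ and adjacency matrix $A\in\mathbb F_2^{n\times n}$, and suppose that either every vertex of $G$ has odd degree, and put $\bar N:=A+A^2$; or every vertex of $G$ has even degree (zero allowed), and put $\bar N:=A+A^2+\mathbb I$. Let $r$ be the rank of $\bar N$ over $\mathbb F_2$, let $w_1,\dots,w_{n-r}$ be a basis of $\ker\bar N$ and let $J\in\mathbb F_2^{(n-r)\times n}$ have rows $w_1^\top,\dots,w_{n-r}^\top$. Then in the Neighborhood Lights Out game on $G$, an initial state $i$ can be transformed into a final state $f$ if and only if $Ji=Jf$.
   Context: Neighborhood Lights Out game on $G$ (played only when all degrees are odd, or all degrees are even/zero): a state is $x\in\mathbb F_2^n$ ($x_j=1$ means the light at $v_j$ is on). Pressing the button at $v_i$ toggles the light at $v_i$ and the light at each vertex $v_k\neq v_i$ joined to $v_i$ by an odd total number of paths of length $1$ or $2$ (vertices joined by an even number of such paths keep their status). Arithmetic over $\mathbb F_2$. A state $i$ can be transformed into $f$ if some finite sequence of button presses turns $i$ into $f$. -}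

module Defs where

open import Data.Bool using (Bool; true; false; _∧_; _xor_; if_then_else_; not)
open import Data.Nat using (ℕ; zero; suc; _+_; _%_)
open import Data.Fin using (Fin; zero; suc)
open import Data.List using (List; []; _∷_; foldl)
open import Data.Sum using (_⊎_; inj₁; inj₂)
open import Data.Product using (Σ; _×_)
open import Relation.Binary.PropositionalEquality using (_≡_)
open import Relation.Nullary using (¬_; Dec; yes; no)
open import Data.Fin using (_≟_)
open import Relation.Nullary.Decidable using (⌊_⌋)

-- Vectors and matrices over 𝔽₂ (Bool with xor as +, ∧ as ·), as functions.
Vec₂ : ℕ → Set
Vec₂ n = Fin n → Bool

Mat₂ : ℕ → ℕ → Set
Mat₂ m n = Fin m → Fin n → Bool

Σ₂ : (n : ℕ) → (Fin n → Bool) → Bool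
Σ₂ zero    f = false
Σ₂ (suc n) f = f zero xor Σ₂ n (λ j → f (suc j))

count : (n : ℕ) → (Fin n → Bool) → ℕ
count zero    p = zero
count (suc n) p = (if p zero then 1 else 0) + count n (λ j → p (suc j))

dot : {n : ℕ} → Vec₂ n → Vec₂ n → Bool
dot {n} u v = Σ₂ n (λ j → u j ∧ v j)

record SimpleGraph (n : ℕ) : Set where
  field
    adj       : Mat₂ n n
    symmetric : ∀ i j → adj i j ≡ adj j i
    loopless  : ∀ i → adj i i ≡ false
open SimpleGraph public

degree : {n : ℕ} → SimpleGraph n → Fin n → ℕ
degree {n} G i = count n (λ j → adj G i j)

AllOdd : {n : ℕ} → SimpleGraph n → Set
AllOdd G = ∀ i → degree G i % 2 ≡ 1

AllEven : {n : ℕ} → SimpleGraph n → Set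
AllEven G = ∀ i → degree G i % 2 ≡ 0

_⊕ₘ_ : {n : ℕ} → Mat₂ n n → Mat₂ n n → Mat₂ n n
(M ⊕ₘ N) i j = M i j xor N i j

_⊗ₘ_ : {n : ℕ} → Mat₂ n n → Mat₂ n n → Mat₂ n n
_⊗ₘ_ {n} M N i j = Σ₂ n (λ k → M i k ∧ N k j)

idₘ : {n : ℕ} → Mat₂ n n
idₘ i j = ⌊ i ≟ j ⌋

Nbar : {n : ℕ} (G : SimpleGraph n) → AllOdd G ⊎ AllEven G → Mat₂ n n
Nbar G (inj₁ _) = adj G ⊕ₘ (adj G ⊗ₘ adj G)
Nbar G (inj₂ _) = (adj G ⊕ₘ (adj G ⊗ₘ adj G)) ⊕ₘ idₘ

InKer : {n : ℕ} → Mat₂ n n → Vec₂ n → Set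
InKer {n} M x = ∀ i → Σ₂ n (λ j → M i j ∧ x j) ≡ false

lincomb : {m n : ℕ} → (Fin m → Vec₂ n) → Vec₂ m → Vec₂ n
lincomb {m} w c k = Σ₂ m (λ l → c l ∧ w l k)

IsKernelBasis : {m n : ℕ} → Mat₂ n n → (Fin m → Vec₂ n) → Set
IsKernelBasis {m} {n} M w =
  (∀ l → InKer M (w l)) ×
  (∀ (c : Vec₂ m) → (∀ k → lincomb w c k ≡ false) → ∀ l → c l ≡ false) ×
  (∀ (x : Vec₂ n) → InKer M x → Σ (Vec₂ m) (λ c → ∀ k → x k ≡ lincomb w c k))

pathCount : {n : ℕ} → SimpleGraph n → Fin n → Fin n → ℕ
pathCount {n} G i k =
  (if adj G i k then 1 else 0)
  + count n (λ j → not ⌊ j ≟ i ⌋ ∧ not ⌊ j ≟ k ⌋ ∧ adj G i j ∧ adj G j k)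

-- Effect of pressing the button at vertex v_i: toggles v_i and each v_k ≠ v_i
-- joined to v_i by an odd number of paths of length 1 or 2.
toggles : {n : ℕ} → SimpleGraph n → Fin n → Fin n → Bool
toggles G i k with i ≟ k
... | yes _ = true
... | no  _ = pathCount G i k % 2 Data.Nat.≡ᵇ 1

press : {n : ℕ} → SimpleGraph n → Fin n → Vec₂ n → Vec₂ n
press G i x k = x k xor toggles G i k

pressAll : {n : ℕ} → SimpleGraph n → List (Fin n) → Vec₂ n → Vec₂ n
pressAll G ps x = foldl (λ y i → press G i y) x ps

Transformable : {n : ℕ} → SimpleGraph n → Vec₂ n → Vec₂ n → Set
Transformable G s t = Σ (List _) (λ ps → ∀ k → pressAll G ps s k ≡ t k)

module Submission where

-- Pressing button p adds the toggle
-- vector  toggles G p  to the state, so i can be transformed into f exactly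
-- when i + f lies in the span of the toggle vectors.
-- The theorem follows: rows of J lie in ker N̄, so Ji is invariant; conversely,
-- if i + f were outside the span, the separating vector would lie in ker N̄,
-- hence in the span of the rows of J, hence be orthogonal to i + f.

open import Defs
open import Data.Nat using (ℕ)
open import Data.Fin using (Fin)
open import Data.Sum using (_⊎_)
open import Data.Product using (_×_)
open import Relation.Binary.PropositionalEquality using (_≡_)

open import Algebra.Bundles using (CommutativeRing)
open import Data.Bool using (Bool; true; false; _∧_; _xor_; not; if_then_else_)
open import Data.Bool.Properties
  using ( ∧-assoc; ∧-comm; ∧-zeroʳ; ∧-idem; ∧-distribˡ-xor; ∧-distribʳ-xor
        ; xor-assoc; xor-comm; xor-same; xor-identityʳ; xor-∧-commutativeRing; ¬-not)
open import Data.Nat using (zero; suc; _+_; _%_; _≡ᵇ_)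
open import Data.Fin using (zero; suc; _≟_)
open import Data.Fin.Properties using (any?)
open import Data.List using (List; []; _∷_; map; foldr)
open import Data.List.Properties using (foldr-map)
open import Data.Vec.Functional using (head; tail) renaming (_∷_ to _∷ᵥ_)
open import Data.Sum using (inj₁; inj₂)
open import Data.Product using (Σ; _,_)
open import Relation.Binary.PropositionalEquality using (refl; sym; trans; cong; cong₂; module ≡-Reasoning)
open import Relation.Nullary using (yes; no; contradiction)
open import Relation.Nullary.Decidable using (⌊_⌋)
open import Function using (_∘_)

open import Algebra.Properties.CommutativeSemigroup
  (CommutativeRing.+-commutativeSemigroup xor-∧-commutativeRing)
  using (interchange)

open ≡-Reasoning

xor-cancelˡ : ∀ a b → a xor (a xor b) ≡ b
xor-cancelˡ a b = trans (sym (xor-assoc a a b)) (cong (_xor b) (xor-same a))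

xor-cancelʳ : ∀ a c → (a xor c) xor c ≡ a
xor-cancelʳ a c = trans (xor-assoc a c c) (trans (cong (a xor_) (xor-same c)) (xor-identityʳ a))

xor-injectiveʳ : ∀ {a b} c → a xor c ≡ b xor c → a ≡ b
xor-injectiveʳ {a} {b} c e = begin
  a                ≡⟨ sym (xor-cancelʳ a c) ⟩
  (a xor c) xor c  ≡⟨ cong (_xor c) e ⟩
  (b xor c) xor c  ≡⟨ xor-cancelʳ b c ⟩
  b                ∎

Σ₂-cong : ∀ n {f g : Fin n → Bool} → (∀ j → f j ≡ g j) → Σ₂ n f ≡ Σ₂ n g
Σ₂-cong zero    e = refl
Σ₂-cong (suc n) e = cong₂ _xor_ (e zero) (Σ₂-cong n (e ∘ suc))

Σ₂-zero : ∀ n {f : Fin n → Bool} → (∀ j → f j ≡ false) → Σ₂ n f ≡ false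
Σ₂-zero zero    e = refl
Σ₂-zero (suc n) e = cong₂ _xor_ (e zero) (Σ₂-zero n (e ∘ suc))

Σ₂-xor : ∀ n (f g : Fin n → Bool) → Σ₂ n (λ j → f j xor g j) ≡ Σ₂ n f xor Σ₂ n g
Σ₂-xor zero    f g = refl
Σ₂-xor (suc n) f g =
  trans (cong ((f zero xor g zero) xor_) (Σ₂-xor n (f ∘ suc) (g ∘ suc)))
        (interchange (f zero) (g zero) (Σ₂ n (f ∘ suc)) (Σ₂ n (g ∘ suc)))

Σ₂-∧ˡ : ∀ n c (f : Fin n → Bool) → Σ₂ n (λ j → c ∧ f j) ≡ c ∧ Σ₂ n f
Σ₂-∧ˡ n true  f = refl
Σ₂-∧ˡ n false f = Σ₂-zero n (λ _ → refl)

Σ₂-swap : ∀ n m (F : Fin n → Fin m → Bool) →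
          Σ₂ n (λ j → Σ₂ m (F j)) ≡ Σ₂ m (λ a → Σ₂ n (λ j → F j a))
Σ₂-swap zero    m F = sym (Σ₂-zero m (λ _ → refl))
Σ₂-swap (suc n) m F =
  trans (cong (Σ₂ m (F zero) xor_) (Σ₂-swap n m (F ∘ suc)))
        (sym (Σ₂-xor m (F zero) (λ a → Σ₂ n (λ j → F (suc j) a))))

≟-suc : ∀ {n} (q j : Fin n) → ⌊ suc q ≟ suc j ⌋ ≡ ⌊ q ≟ j ⌋
≟-suc q j with q ≟ j
... | yes refl = refl
... | no  _    = refl

Σ₂-unit : ∀ n (q : Fin n) (g : Fin n → Bool) → Σ₂ n (λ j → ⌊ q ≟ j ⌋ ∧ g j) ≡ g q
Σ₂-unit (suc n) zero    g = trans (cong (g zero xor_) (Σ₂-zero n (λ _ → refl))) (xor-identityʳ (g zero))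
Σ₂-unit (suc n) (suc q) g =
  trans (Σ₂-cong n (λ j → cong (_∧ g (suc j)) (≟-suc q j))) (Σ₂-unit n q (g ∘ suc))

-- Note that  lincomb w c k  is by definition  dot c (λ l → w l k).

dot-comm : ∀ {n} (u v : Vec₂ n) → dot u v ≡ dot v u
dot-comm {n} u v = Σ₂-cong n (λ k → ∧-comm (u k) (v k))

dot-cong : ∀ {n} {u u′ v v′ : Vec₂ n} → (∀ k → u k ≡ u′ k) → (∀ k → v k ≡ v′ k) →
           dot u v ≡ dot u′ v′
dot-cong {n} eu ev = Σ₂-cong n (λ k → cong₂ _∧_ (eu k) (ev k))

dot-xorʳ : ∀ {n} (u v w : Vec₂ n) → dot u (λ k → v k xor w k) ≡ dot u v xor dot u w
dot-xorʳ {n} u v w =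
  trans (Σ₂-cong n (λ k → ∧-distribˡ-xor (u k) (v k) (w k))) (Σ₂-xor n _ _)

dot-scaleˡ : ∀ {n} (u : Vec₂ n) c (v : Vec₂ n) → dot u (λ k → c ∧ v k) ≡ c ∧ dot u v
dot-scaleˡ     u true  v = refl
dot-scaleˡ {n} u false v = Σ₂-zero n (λ k → ∧-zeroʳ (u k))

dot-scaleʳ : ∀ {n} (u v : Vec₂ n) c → dot u (λ k → v k ∧ c) ≡ dot u v ∧ c
dot-scaleʳ {n} u v c = begin
  dot u (λ k → v k ∧ c)  ≡⟨ Σ₂-cong n (λ k → cong (u k ∧_) (∧-comm (v k) c)) ⟩
  dot u (λ k → c ∧ v k)  ≡⟨ dot-scaleˡ u c v ⟩
  c ∧ dot u v            ≡⟨ ∧-comm c (dot u v) ⟩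
  dot u v ∧ c            ∎

dot-lincomb : ∀ {m n} (w : Fin m → Vec₂ n) (c : Vec₂ m) (v : Vec₂ n) →
              dot (lincomb w c) v ≡ dot c (λ l → dot (w l) v)
dot-lincomb {m} {n} w c v = begin
  Σ₂ n (λ k → lincomb w c k ∧ v k)
    ≡⟨ Σ₂-cong n (λ k → sym (dot-scaleʳ c (λ l → w l k) (v k))) ⟩
  Σ₂ n (λ k → Σ₂ m (λ l → c l ∧ (w l k ∧ v k)))
    ≡⟨ Σ₂-swap n m (λ k l → c l ∧ (w l k ∧ v k)) ⟩
  Σ₂ m (λ l → Σ₂ n (λ k → c l ∧ (w l k ∧ v k)))
    ≡⟨ Σ₂-cong m (λ l → Σ₂-∧ˡ n (c l) (λ k → w l k ∧ v k)) ⟩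
  dot c (λ l → dot (w l) v)  ∎

span-orthogonal : ∀ {m n} (w : Fin m → Vec₂ n) (c : Vec₂ m) (v : Vec₂ n) →
                  (∀ l → dot (w l) v ≡ false) → dot (lincomb w c) v ≡ false
span-orthogonal {m} w c v w⊥v =
  trans (dot-lincomb w c v) (Σ₂-zero m (λ l → trans (cong (c l ∧_) (w⊥v l)) (∧-zeroʳ (c l))))

lincomb-shift : ∀ {m n} (w : Fin m → Vec₂ n) (c : Vec₂ m) (q : Fin m) (s : Bool) (k : Fin n) →
                lincomb w (λ j → c j xor (⌊ q ≟ j ⌋ ∧ s)) k ≡ lincomb w c k xor (s ∧ w q k)
lincomb-shift {m} w c q s k = begin
  Σ₂ m (λ j → (c j xor (⌊ q ≟ j ⌋ ∧ s)) ∧ w j k)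
    ≡⟨ Σ₂-cong m (λ j → ∧-distribʳ-xor (w j k) (c j) (⌊ q ≟ j ⌋ ∧ s)) ⟩
  Σ₂ m (λ j → (c j ∧ w j k) xor ((⌊ q ≟ j ⌋ ∧ s) ∧ w j k))
    ≡⟨ Σ₂-xor m _ _ ⟩
  lincomb w c k xor Σ₂ m (λ j → (⌊ q ≟ j ⌋ ∧ s) ∧ w j k)
    ≡⟨ cong (lincomb w c k xor_) (Σ₂-cong m (λ j → ∧-assoc ⌊ q ≟ j ⌋ s (w j k))) ⟩
  lincomb w c k xor Σ₂ m (λ j → ⌊ q ≟ j ⌋ ∧ (s ∧ w j k))
    ≡⟨ cong (lincomb w c k xor_) (Σ₂-unit m q (λ j → s ∧ w j k)) ⟩
  lincomb w c k xor (s ∧ w q k)  ∎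

-- The Fredholm alternative over 𝔽₂

InSpan : ∀ {m n} → (Fin m → Vec₂ n) → Vec₂ n → Set
InSpan {m} w b = Σ (Vec₂ m) (λ c → ∀ k → lincomb w c k ≡ b k)

Separates : ∀ {m n} → Vec₂ n → (Fin m → Vec₂ n) → Vec₂ n → Set
Separates {m} y w b = (∀ l → dot y (w l) ≡ false) × dot y b ≡ true

SpanOrSeparated : ∀ {m n} → (Fin m → Vec₂ n) → Vec₂ n → Set
SpanOrSeparated {m} {n} w b = InSpan w b ⊎ Σ (Vec₂ n) (λ y → Separates y w b)

-- Elimination along a pivot vector p with p₀ = 1: the linear map
-- v ↦ v − v₀·p, followed by dropping the (now zero) first coordinate.
eliminate : ∀ {n} → Vec₂ (suc n) → Vec₂ (suc n) → Vec₂ n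
eliminate p v a = v (suc a) xor (v zero ∧ p (suc a))

lincomb-eliminate : ∀ {m n} (p : Vec₂ (suc n)) (w : Fin m → Vec₂ (suc n)) (c : Vec₂ m) (a : Fin n) →
                    lincomb (eliminate p ∘ w) c a ≡ eliminate p (lincomb w c) a
lincomb-eliminate p w c a =
  trans (dot-xorʳ c (λ l → w l (suc a)) (λ l → w l zero ∧ p (suc a)))
        (cong (lincomb w c (suc a) xor_) (dot-scaleʳ c (λ l → w l zero) (p (suc a))))

eliminate-pivot : ∀ {n} (p : Vec₂ (suc n)) → p zero ≡ true → ∀ a → eliminate p p a ≡ false
eliminate-pivot p p₀ a = trans (cong (λ t → p (suc a) xor (t ∧ p (suc a))) p₀) (xor-same (p (suc a)))

eliminate-injective : ∀ {n} (p x y : Vec₂ (suc n)) → x zero ≡ y zero →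
                      (∀ a → eliminate p x a ≡ eliminate p y a) → ∀ k → x k ≡ y k
eliminate-injective p x y e₀ e zero    = e₀
eliminate-injective p x y e₀ e (suc a) =
  xor-injectiveʳ (y zero ∧ p (suc a)) (trans (cong (λ t → x (suc a) xor (t ∧ p (suc a))) (sym e₀)) (e a))

dot-eliminate : ∀ {n} (p : Vec₂ (suc n)) (y′ : Vec₂ n) (v : Vec₂ (suc n)) →
                dot (dot y′ (tail p) ∷ᵥ y′) v ≡ dot y′ (eliminate p v)
dot-eliminate p y′ v = begin
  (dot y′ (tail p) ∧ v zero) xor dot y′ (tail v)
    ≡⟨ xor-comm (dot y′ (tail p) ∧ v zero) (dot y′ (tail v)) ⟩
  dot y′ (tail v) xor (dot y′ (tail p) ∧ v zero)
    ≡⟨ cong (dot y′ (tail v) xor_) (∧-comm (dot y′ (tail p)) (v zero)) ⟩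
  dot y′ (tail v) xor (v zero ∧ dot y′ (tail p))
    ≡⟨ cong (dot y′ (tail v) xor_) (sym (dot-scaleˡ y′ (v zero) (tail p))) ⟩
  dot y′ (tail v) xor dot y′ (λ a → v zero ∧ p (suc a))
    ≡⟨ sym (dot-xorʳ y′ (tail v) (λ a → v zero ∧ p (suc a))) ⟩
  dot y′ (eliminate p v)  ∎

no-pivot-step : ∀ {m n} (w : Fin m → Vec₂ (suc n)) (b : Vec₂ (suc n)) →
                (∀ l → w l zero ≡ false) →
                SpanOrSeparated (tail ∘ w) (tail b) → SpanOrSeparated w b
no-pivot-step {m} {n} w b w₀≡0 rest with b zero Data.Bool.≟ true
... | yes b₀≡1 = inj₂ (idₘ zero , (λ l → trans (Σ₂-unit (suc n) zero (w l)) (w₀≡0 l))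
                               , trans (Σ₂-unit (suc n) zero b) b₀≡1)
... | no  b₀≢1 with rest
...   | inj₁ (c , sol) = inj₁ (c , λ { zero    → trans first-coordinate (sym (¬-not b₀≢1))
                                      ; (suc k) → sol k })
  where
  first-coordinate : lincomb w c zero ≡ false
  first-coordinate = Σ₂-zero m (λ l → trans (cong (c l ∧_) (w₀≡0 l)) (∧-zeroʳ (c l)))
...   | inj₂ (y , y⊥w , y·b) = inj₂ (false ∷ᵥ y , y⊥w , y·b)

-- Elimination step with a pivot generator w_q (w_q(0) = 1): a solution c for
-- the eliminated system is corrected at q; a separator y′ is pulled back.
pivot-step : ∀ {m n} (w : Fin m → Vec₂ (suc n)) (b : Vec₂ (suc n)) (q : Fin m) →
             w q zero ≡ true →
             SpanOrSeparated (eliminate (w q) ∘ w) (eliminate (w q) b) → SpanOrSeparated w b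
pivot-step w b q pivot (inj₁ (c , sol)) =
  inj₁ (c′ , eliminate-injective (w q) (lincomb w c′) b first-coordinate eliminated)
  where
  s : Bool
  s = lincomb w c zero xor b zero
  c′ : Vec₂ _
  c′ j = c j xor (⌊ q ≟ j ⌋ ∧ s)
  first-coordinate : lincomb w c′ zero ≡ b zero
  first-coordinate = begin
    lincomb w c′ zero                  ≡⟨ lincomb-shift w c q s zero ⟩
    lincomb w c zero xor (s ∧ w q zero) ≡⟨ cong (λ t → lincomb w c zero xor (s ∧ t)) pivot ⟩
    lincomb w c zero xor (s ∧ true)     ≡⟨ cong (lincomb w c zero xor_) (∧-comm s true) ⟩
    lincomb w c zero xor s              ≡⟨ xor-cancelˡ (lincomb w c zero) (b zero) ⟩
    b zero                              ∎
  eliminated : ∀ a → eliminate (w q) (lincomb w c′) a ≡ eliminate (w q) b a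
  eliminated a = begin
    eliminate (w q) (lincomb w c′) a
      ≡⟨ sym (lincomb-eliminate (w q) w c′ a) ⟩
    lincomb (eliminate (w q) ∘ w) c′ a
      ≡⟨ lincomb-shift (eliminate (w q) ∘ w) c q s a ⟩
    lincomb (eliminate (w q) ∘ w) c a xor (s ∧ eliminate (w q) (w q) a)
      ≡⟨ cong (λ t → lincomb (eliminate (w q) ∘ w) c a xor (s ∧ t)) (eliminate-pivot (w q) pivot a) ⟩
    lincomb (eliminate (w q) ∘ w) c a xor (s ∧ false)
      ≡⟨ trans (cong (lincomb (eliminate (w q) ∘ w) c a xor_) (∧-zeroʳ s)) (xor-identityʳ _) ⟩
    lincomb (eliminate (w q) ∘ w) c a
      ≡⟨ sol a ⟩
    eliminate (w q) b a  ∎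
pivot-step w b q pivot (inj₂ (y′ , y′⊥w , y′·b)) =
  inj₂ (dot y′ (tail (w q)) ∷ᵥ y′
       , (λ l → trans (dot-eliminate (w q) y′ (w l)) (y′⊥w l))
       , trans (dot-eliminate (w q) y′ b) y′·b)

fredholm : ∀ n {m} (w : Fin m → Vec₂ n) (b : Vec₂ n) → SpanOrSeparated w b
fredholm zero    w b = inj₁ ((λ _ → false) , λ ())
fredholm (suc n) w b with any? (λ l → w l zero Data.Bool.≟ true)
... | yes (q , pivot) = pivot-step w b q pivot (fredholm n (eliminate (w q) ∘ w) (eliminate (w q) b))
... | no  no-pivot    = no-pivot-step w b (λ l → ¬-not (λ w₀ → no-pivot (l , w₀)))
                                          (fredholm n (tail ∘ w) (tail b))

-- The parity of k, in the form used by the definition of toggles.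
odd? : ℕ → Bool
odd? k = k % 2 ≡ᵇ 1

odd?-suc : ∀ k → odd? (suc k) ≡ not (odd? k)
odd?-suc zero          = refl
odd?-suc (suc zero)    = refl
odd?-suc (suc (suc k)) = odd?-suc k

odd?-indicator+ : ∀ b c → odd? ((if b then 1 else 0) + c) ≡ b xor odd? c
odd?-indicator+ true  c = odd?-suc c
odd?-indicator+ false c = refl

odd?-count : ∀ n (p : Fin n → Bool) → odd? (count n p) ≡ Σ₂ n p
odd?-count zero    p = refl
odd?-count (suc n) p =
  trans (odd?-indicator+ (p zero) (count n (tail p))) (cong (p zero xor_) (odd?-count n (tail p)))

-- Toggle vectors are the rows of N̄

module _ {n : ℕ} (G : SimpleGraph n) where

  private
    A : Mat₂ n n
    A = adj G

  -- A path i – j – k with j ∈ {i, k} would need a loop, so excluding the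
  -- endpoints as middle vertices changes nothing.
  middle-avoids-ends : ∀ i k j → (not ⌊ j ≟ i ⌋ ∧ not ⌊ j ≟ k ⌋ ∧ A i j ∧ A j k) ≡ (A i j ∧ A j k)
  middle-avoids-ends i k j with j ≟ i
  ... | yes refl = sym (cong (_∧ A j k) (loopless G j))
  ... | no  _ with j ≟ k
  ...   | yes refl = sym (trans (cong (A i j ∧_) (loopless G j)) (∧-zeroʳ (A i j)))
  ...   | no  _    = refl

  pathCount-parity : ∀ i k → odd? (pathCount G i k) ≡ (A ⊕ₘ (A ⊗ₘ A)) i k
  pathCount-parity i k =
    trans (odd?-indicator+ (A i k) _)
          (cong (A i k xor_) (trans (odd?-count n _) (Σ₂-cong n (middle-avoids-ends i k))))

  -- The diagonal of A + A² counts the neighbours: its parity is that of the degree.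
  degree-parity : ∀ i → (A ⊕ₘ (A ⊗ₘ A)) i i ≡ odd? (degree G i)
  degree-parity i = begin
    A i i xor Σ₂ n (λ j → A i j ∧ A j i)  ≡⟨ cong (_xor Σ₂ n (λ j → A i j ∧ A j i)) (loopless G i) ⟩
    Σ₂ n (λ j → A i j ∧ A j i)            ≡⟨ Σ₂-cong n (λ j → trans (cong (A i j ∧_) (symmetric G j i)) (∧-idem (A i j))) ⟩
    Σ₂ n (A i)                            ≡⟨ sym (odd?-count n (A i)) ⟩
    odd? (degree G i)                     ∎

  -- The toggle vector of i is the i-th row of N̄: on the diagonal the degree
  -- parity hypothesis makes the entry 1, off the diagonal it is the path parity.
  toggles≡Nbar : ∀ h i k → toggles G i k ≡ Nbar G h i k
  toggles≡Nbar (inj₁ odd)  i k with i ≟ k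
  ... | yes refl = sym (trans (degree-parity i) (cong (_≡ᵇ 1) (odd i)))
  ... | no  _    = pathCount-parity i k
  toggles≡Nbar (inj₂ even) i k with i ≟ k
  ... | yes refl = sym (cong (_xor true) (trans (degree-parity i) (cong (_≡ᵇ 1) (even i))))
  ... | no  _    = trans (pathCount-parity i k) (sym (xor-identityʳ _))

  dot-toggles : ∀ h (x : Vec₂ n) p → dot x (toggles G p) ≡ Σ₂ n (λ j → Nbar G h p j ∧ x j)
  dot-toggles h x p =
    trans (Σ₂-cong n (λ j → cong (x j ∧_) (toggles≡Nbar h p j))) (dot-comm x (Nbar G h p))

listSum : ∀ {n} → (Fin n → Bool) → List (Fin n) → Bool
listSum f = foldr (λ p s → f p xor s) false

support : ∀ {n} → Vec₂ n → List (Fin n)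
support {zero}  c = []
support {suc n} c = if head c then zero ∷ rest else rest
  where
  rest : List (Fin (suc n))
  rest = map suc (support (tail c))

listSum-support : ∀ {n} (c f : Vec₂ n) → listSum f (support c) ≡ dot c f
listSum-support {zero}  c f = refl
listSum-support {suc n} c f with c zero
... | true  = cong (f zero xor_) tail-sum
  where
  tail-sum : listSum f (map suc (support (tail c))) ≡ dot (tail c) (tail f)
  tail-sum = trans (foldr-map _ suc false (support (tail c))) (listSum-support (tail c) (tail f))
... | false = trans (foldr-map _ suc false (support (tail c))) (listSum-support (tail c) (tail f))

module _ {n : ℕ} (G : SimpleGraph n) where

  -- Pressing p adds the toggle vector of p, so dot products with a vector
  -- orthogonal to all toggle vectors never change.
  pressAll-preserves : (u : Vec₂ n) → (∀ p → dot u (toggles G p) ≡ false) →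
                       ∀ ps x → dot u (pressAll G ps x) ≡ dot u x
  pressAll-preserves u u⊥T []       x = refl
  pressAll-preserves u u⊥T (p ∷ ps) x = begin
    dot u (pressAll G ps (press G p x))  ≡⟨ pressAll-preserves u u⊥T ps (press G p x) ⟩
    dot u (press G p x)                  ≡⟨ dot-xorʳ u x (toggles G p) ⟩
    dot u x xor dot u (toggles G p)      ≡⟨ cong (dot u x xor_) (u⊥T p) ⟩
    dot u x xor false                    ≡⟨ xor-identityʳ (dot u x) ⟩
    dot u x                              ∎

  pressAll-sum : ∀ ps x k → pressAll G ps x k ≡ x k xor listSum (λ p → toggles G p k) ps
  pressAll-sum []       x k = sym (xor-identityʳ (x k))
  pressAll-sum (p ∷ ps) x k =
    trans (pressAll-sum ps (press G p x) k) (xor-assoc (x k) (toggles G p k) _)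

  pressAll-support : ∀ c x k → pressAll G (support c) x k ≡ x k xor lincomb (toggles G) c k
  pressAll-support c x k =
    trans (pressAll-sum (support c) x k) (cong (x k xor_) (listSum-support c (λ p → toggles G p k)))

theorem5 : (n : ℕ) (G : SimpleGraph n) (h : AllOdd G ⊎ AllEven G)
           (m : ℕ) (J : Fin m → Vec₂ n) → IsKernelBasis (Nbar G h) J →
           (i f : Vec₂ n) →
           (Transformable G i f → (∀ l → dot (J l) i ≡ dot (J l) f)) ×
           ((∀ l → dot (J l) i ≡ dot (J l) f) → Transformable G i f)
theorem5 n G h m J (J⊆ker , _ , ker⊆span) i f = invariant , reachable
  where
  δ : Vec₂ n
  δ k = i k xor f k

  invariant : Transformable G i f → ∀ l → dot (J l) i ≡ dot (J l) f
  invariant (ps , reaches) l =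
    trans (sym (pressAll-preserves G (J l) (λ p → trans (dot-toggles G h (J l) p) (J⊆ker l p)) ps i))
          (dot-cong (λ _ → refl) reaches)

  reachable : (∀ l → dot (J l) i ≡ dot (J l) f) → Transformable G i f
  -- Either δ is a combination of toggle vectors, realised by pressing its
  -- support, or a separator y exists; y lies in ker N̄ = span J, which is
  -- orthogonal to δ because Ji = Jf, contradicting y·δ = 1.
  reachable same with fredholm n (toggles G) δ
  ... | inj₁ (c , c↦δ) =
    support c , λ k → trans (pressAll-support G c i k) (trans (cong (i k xor_) (c↦δ k)) (xor-cancelˡ (i k) (f k)))
  ... | inj₂ (y , y⊥T , y·δ) with ker⊆span y (λ p → trans (sym (dot-toggles G h y p)) (y⊥T p))
  ...   | (c , y≡Jc) = contradiction (trans (sym y·δ) y⊥δ) λ ()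
    where
    J⊥δ : ∀ l → dot (J l) δ ≡ false
    J⊥δ l = trans (dot-xorʳ (J l) i f) (trans (cong (_xor dot (J l) f) (same l)) (xor-same (dot (J l) f)))
    y⊥δ : dot y δ ≡ false
    y⊥δ = trans (dot-cong y≡Jc (λ _ → refl)) (span-orthogonal J c δ J⊥δ)
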